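{- Let $G=(X,Y,E)$ be a uniformly random $\Delta$-regular bipartite graph. Then with high probability over the randomness of $G$, there is no vertex $x\in X$ that shares at least $2$ common neighbors with more than one other vertex.
   Context: A random $\Delta$-regular bipartite graph is uniform over simple $\Delta$-regular bipartite graphs with sides $|X|=|Y|=n/2$; "with high probability" means probability $\to1$ as $n\to\infty$. -}

module Defs where

open import Data.Bool using (Bool; true; false; _∧_; _∨_; not; if_then_else_)
open import Data.Nat using (ℕ; zero; suc; _+_; _≡ᵇ_; _≤ᵇ_)
open import Data.Fin using (Fin; _≟_)
open import Data.Fin as Fin using ()
open import Data.List using (List; []; _∷_; map; concatMap; filter; length)
open import Data.Vec.Functional using () renaming (_∷_ to _◂_)
open import Relation.Nullary.Decidable using (⌊_⌋)
open import Data.Bool.Properties using (T?)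

-- A bipartite graph G = (X, Y, E) with |X| = |Y| = m, given by its
-- biadjacency relation: A x y = true iff {x, y} ∈ E.  Every such
-- function is a simple bipartite graph on labelled vertex sets, and
-- conversely.
BipGraph : ℕ → Set
BipGraph m = Fin m → Fin m → Bool

count : (k : ℕ) → (Fin k → Bool) → ℕ
count zero    p = 0
count (suc k) p = (if p Fin.zero then 1 else 0) + count k (λ i → p (Fin.suc i))

allFuns : {A : Set} → List A → (n : ℕ) → List (Fin n → A)
allFuns xs zero    = (λ ()) ∷ []
allFuns xs (suc n) = concatMap (λ a → map (λ f → a ◂ f) (allFuns xs n)) xs

-- All bipartite graphs with sides of size m (enumerated, each exactly once).
allBipGraphs : (m : ℕ) → List (BipGraph m)
allBipGraphs m = allFuns (allFuns (true ∷ false ∷ []) m) m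

allF : (k : ℕ) → (Fin k → Bool) → Bool
allF k p = count k (λ i → not (p i)) ≡ᵇ 0

anyF : (k : ℕ) → (Fin k → Bool) → Bool
anyF k p = not (count k p ≡ᵇ 0)

isΔRegular : (Δ m : ℕ) → BipGraph m → Bool
isΔRegular Δ m A =
  allF m (λ x → count m (A x) ≡ᵇ Δ) ∧ allF m (λ y → count m (λ x → A x y) ≡ᵇ Δ)

codeg : (m : ℕ) → BipGraph m → Fin m → Fin m → ℕ
codeg m A x x' = count m (λ y → A x y ∧ A x' y)

isBad : (m : ℕ) → BipGraph m → Bool
isBad m A =
  anyF m (λ x → 2 ≤ᵇ count m (λ x' → not ⌊ x ≟ x' ⌋ ∧ (2 ≤ᵇ codeg m A x x')))

numRegular : (Δ m : ℕ) → ℕ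
numRegular Δ m = length (filter (λ A → T? (isΔRegular Δ m A)) (allBipGraphs m))

numRegularBad : (Δ m : ℕ) → ℕ
numRegularBad Δ m =
  length (filter (λ A → T? (isΔRegular Δ m A ∧ isBad m A)) (allBipGraphs m))

-- The switching method.  For a list H of distinct edges and an edge uv ∉ H,
-- switching uv, ab ↦ ub, av maps every Δ-regular graph containing uv ∷ H,
-- together with any of its at least mΔ − 2Δ² − |H| admissible edges ab, to a
-- Δ-regular graph containing H, and each such graph is reached at most Δ²
-- times.  So for m ≥ 4Δ + 2|H| one more prescribed edge costs a factor 2Δ/m,
-- and e prescribed edges lie in at most a (2Δ/m)^e fraction of the regular
-- graphs.  A bad graph contains a copy of one of three patterns (x and two
-- partners whose pairs of common neighbours are disjoint, meet, or coincide).
-- Each has one more edge than vertices, so copies of it are expected at most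
-- (2Δ)^e / m times in a random regular graph.

{-# OPTIONS --safe #-}
module Submission where

open import Defs
open import Data.Nat using (ℕ; _*_; _≤_; _≥_; suc)
open import Data.Product using (∃-syntax)

open import Data.Nat using (zero; _+_; _^_; _≡ᵇ_; _≤ᵇ_; z≤n; s≤s; s≤s⁻¹; NonZero; >-nonZero)
open import Data.Nat.Properties hiding (_≟_)
open import Algebra.Properties.CommutativeSemigroup +-commutativeSemigroup
  using (interchange) renaming (x∙yz≈y∙xz to x+[y+z]≡y+[x+z])
open import Algebra.Properties.CommutativeSemigroup *-commutativeSemigroup
  using () renaming (x∙yz≈y∙xz to x*[y*z]≡y*[x*z])
open import Algebra.Properties.Semiring.Sum +-*-semiring
  using (sum; sum-syntax; sum-cong-≗; sum-replicate-zero; sum-permute;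
         ∑-distrib-+; ∑-comm; *-distribˡ-sum; *-distribʳ-sum)
open import Data.Bool using (Bool; true; false; _∧_; _∨_; _xor_; not; if_then_else_; T)
open import Data.Bool.ListAction using (and; all)
open import Data.Bool.Properties using (T?; T-≡; T-not-≡; T-∧; ∧-identityʳ; xor-comm; xor-identityʳ)
open import Data.Empty using (⊥; ⊥-elim)
open import Data.Fin using (Fin; _≟_; #_)
open import Data.Fin.Permutation using (Permutation; _⟨$⟩ʳ_; transpose)
import Data.Fin.Permutation.Components as PC
import Data.Fin.Properties as Finₚ
open import Data.List using (List; []; _∷_; map; concatMap; filter; length; _++_; allFin)
open import Data.List.Membership.Propositional using (_∈_)
open import Data.List.Membership.Propositional.Properties using (∈-allFin)
open import Data.List.Properties using (map-cong; length-map; length-tabulate)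
open import Data.List.Relation.Unary.All using (All; []; _∷_)
import Data.List.Relation.Unary.All as All
open import Data.List.Relation.Unary.All.Properties using (all⁺; all⁻; All¬⇒¬Any)
open import Data.List.Relation.Unary.AllPairs using ([]; _∷_)
open import Data.List.Relation.Unary.Any using (any?; here; there)
open import Data.List.Relation.Unary.Unique.Propositional using (Unique)
import Data.List.Relation.Unary.Unique.Propositional.Properties as Uniqueₚ
import Data.List.Relation.Unary.Unique.DecPropositional as UniqueDec
open import Data.Nat.Tactic.RingSolver using (solve-∀)
open import Data.Product using (_×_; _,_; proj₁; proj₂; uncurry)
open import Data.Product.Properties using (≡-dec)
open import Data.Sum using (_⊎_; inj₁; inj₂; [_,_])
open import Data.Vec using ([]; _∷_)
import Data.Vec as Vec
open import Data.Vec.Functional using () renaming (_∷_ to _◂_)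
open import Data.Vec.Relation.Unary.All using ([]; _∷_)
open import Data.Vec.Relation.Unary.AllPairs using ([]; _∷_)
import Data.Vec.Relation.Unary.Unique.Propositional as Vecᵘ
import Data.Vec.Relation.Unary.Unique.Propositional.Properties as Vecᵘₚ
open import Function using (_∘_; id)
open import Function.Bundles using (module Equivalence)
open import Function.Definitions using (Injective)
open import Relation.Binary.Definitions using (DecidableEquality)
open import Relation.Binary.PropositionalEquality
  using (_≡_; _≢_; _≗_; refl; sym; trans; cong; cong₂; subst; subst₂; ≢-sym; module ≡-Reasoning)
open import Relation.Nullary using (Dec; yes; no; does; ¬_; _×-dec_; _⊎-dec_)
open import Relation.Nullary.Decidable using (⌊_⌋; dec-true; dec-false; isYes≗does; from-yes)

open Equivalence using (to; from)

private
  variable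
    A B : Set
    k n : ℕ

ind : Bool → ℕ
ind b = if b then 1 else 0

ind-∧ : ∀ a b → ind (a ∧ b) ≡ ind a * ind b
ind-∧ true  b = sym (*-identityˡ (ind b))
ind-∧ false b = refl

ind-∨ : ∀ a b → ind (a ∨ b) ≤ ind a + ind b
ind-∨ true  b = s≤s z≤n
ind-∨ false b = ≤-refl

ind-mono : ∀ {a b} → (T a → T b) → ind a ≤ ind b
ind-mono {false}         _   = z≤n
ind-mono {true} {true}   _   = ≤-refl
ind-mono {true} {false} a⇒b = ⊥-elim (a⇒b _)

ind-∧-exchange : ∀ a b c → ind a * ind (b ∧ c) ≡ ind b * ind (a ∧ c)
ind-∧-exchange a b c = begin
  ind a * ind (b ∧ c)        ≡⟨ cong (ind a *_) (ind-∧ b c) ⟩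
  ind a * (ind b * ind c)    ≡⟨ x*[y*z]≡y*[x*z] (ind a) (ind b) (ind c) ⟩
  ind b * (ind a * ind c)    ≡⟨ cong (ind b *_) (ind-∧ a c) ⟨
  ind b * ind (a ∧ c)        ∎
  where open ≡-Reasoning

does-false : ∀ {P : Set} (d : Dec P) → T (not (does d)) → ¬ P
does-false (no ¬p) _ = ¬p

∑-mono : {f g : Fin n → ℕ} → (∀ i → f i ≤ g i) → ∑[ i < n ] f i ≤ ∑[ i < n ] g i
∑-mono {zero}  f≤g = z≤n
∑-mono {suc n} f≤g = +-mono-≤ (f≤g Fin.zero) (∑-mono (f≤g ∘ Fin.suc))

∑-const : ∀ n c → ∑[ i < n ] c ≡ n * c
∑-const zero    c = refl
∑-const (suc n) c = cong (c +_) (∑-const n c)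

∑-*-∑ : (f g : Fin n → ℕ) → ∑[ i < n ] ∑[ j < n ] (f i * g j) ≡ (∑[ i < n ] f i) * (∑[ j < n ] g j)
∑-*-∑ f g = trans (sum-cong-≗ (λ i → sym (*-distribˡ-sum (f i) g))) (sym (*-distribʳ-sum (sum g) f))

∑-δ : (j : Fin n) → ∑[ i < n ] ind (does (i ≟ j)) ≡ 1
∑-δ {suc n} Fin.zero    = cong suc (sum-replicate-zero n)
∑-δ {suc n} (Fin.suc j) = ∑-δ j

module _ {m n : ℕ} where

  ∑∑-zero : ∑[ i < m ] ∑[ j < n ] 0 ≡ 0
  ∑∑-zero = trans (sum-cong-≗ {m} (λ _ → sum-replicate-zero n)) (sum-replicate-zero m)

  ∑∑-mono : {f g : Fin m → Fin n → ℕ} → (∀ i j → f i j ≤ g i j) →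
            ∑[ i < m ] ∑[ j < n ] f i j ≤ ∑[ i < m ] ∑[ j < n ] g i j
  ∑∑-mono f≤g = ∑-mono (λ i → ∑-mono (f≤g i))

  ∑∑-distrib-+ : (f g : Fin m → Fin n → ℕ) →
                 ∑[ i < m ] ∑[ j < n ] (f i j + g i j)
                   ≡ ∑[ i < m ] ∑[ j < n ] f i j + ∑[ i < m ] ∑[ j < n ] g i j
  ∑∑-distrib-+ f g = trans (sum-cong-≗ (λ i → ∑-distrib-+ (f i) (g i)))
                           (∑-distrib-+ (λ i → ∑[ j < n ] f i j) (λ i → ∑[ j < n ] g i j))

count-cong : {p q : Fin k → Bool} → (∀ i → p i ≡ q i) → count k p ≡ count k q
count-cong {zero}  p≗q = refl
count-cong {suc k} p≗q = cong₂ _+_ (cong ind (p≗q Fin.zero)) (count-cong (p≗q ∘ Fin.suc))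

count≡∑ : (p : Fin k → Bool) → count k p ≡ ∑[ i < k ] ind (p i)
count≡∑ {zero}  p = refl
count≡∑ {suc k} p = cong (ind (p Fin.zero) +_) (count≡∑ (p ∘ Fin.suc))

count-permute : (p : Fin k → Bool) (π : Permutation k k) → count k p ≡ count k (p ∘ (π ⟨$⟩ʳ_))
count-permute p π = begin
  count _ p                        ≡⟨ count≡∑ p ⟩
  ∑[ i < _ ] ind (p i)             ≡⟨ sum-permute (ind ∘ p) π ⟩
  ∑[ i < _ ] ind (p (π ⟨$⟩ʳ i))    ≡⟨ count≡∑ (p ∘ (π ⟨$⟩ʳ_)) ⟨
  count _ (p ∘ (π ⟨$⟩ʳ_))          ∎
  where open ≡-Reasoning

count-exchange : {p q : Fin k → Bool} (i j : Fin k) → p i ≡ q j → p j ≡ q i →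
                 (∀ l → l ≢ i → l ≢ j → p l ≡ q l) → count k p ≡ count k q
count-exchange {p = p} {q} i j pi≡qj pj≡qi elsewhere =
  trans (count-permute p (transpose i j)) (count-cong agree)
  where
  agree : ∀ l → p (PC.transpose i j l) ≡ q l
  agree l with l ≟ i
  ... | yes refl = pj≡qi
  ... | no l≢i with l ≟ j
  ...   | yes refl = pi≡qj
  ...   | no l≢j   = elsewhere l l≢i l≢j

count-witness : {p : Fin k → Bool} → 1 ≤ count k p → ∃[ i ] T (p i)
count-witness {suc k} {p} c with p Fin.zero in eq
... | true  = Fin.zero , from T-≡ eq
... | false with count-witness {p = p ∘ Fin.suc} c
...   | i , pi = Fin.suc i , pi

count-witness₂ : {p : Fin k → Bool} → 2 ≤ count k p → ∃[ i ] ∃[ j ] i ≢ j × T (p i) × T (p j)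
count-witness₂ {suc k} {p} c with p Fin.zero in eq
... | true with count-witness {p = p ∘ Fin.suc} (s≤s⁻¹ c)
...   | j , pj = Fin.zero , Fin.suc j , (λ ()) , from T-≡ eq , pj
count-witness₂ {suc k} {p} c | false with count-witness₂ {p = p ∘ Fin.suc} c
...   | i , j , i≢j , pi , pj = Fin.suc i , Fin.suc j , i≢j ∘ Finₚ.suc-injective , pi , pj

count≡0 : {p : Fin k → Bool} → count k p ≡ 0 → ∀ i → p i ≡ false
count≡0 {suc k} {p} c i with p Fin.zero in eq | i
... | false | Fin.zero  = eq
... | false | Fin.suc j = count≡0 {p = p ∘ Fin.suc} c j

allF-elim : {p : Fin k → Bool} → T (allF k p) → ∀ i → T (p i)
allF-elim {k} {p} all i with p i | count≡0 {p = not ∘ p} (≡ᵇ⇒≡ _ 0 all) i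
... | true | _ = _

anyF-elim : {p : Fin k → Bool} → T (anyF k p) → ∃[ i ] T (p i)
anyF-elim {k} {p} any = count-witness (positive (count k p) any)
  where
  positive : ∀ c → T (not (c ≡ᵇ 0)) → 1 ≤ c
  positive (suc c) _ = s≤s z≤n

∑ₗ : List A → (A → ℕ) → ℕ
∑ₗ []       f = 0
∑ₗ (x ∷ xs) f = f x + ∑ₗ xs f

infixl 10 ∑ₗ
syntax ∑ₗ xs (λ x → e) = ∑[ x ∈ xs ] e

∑ₗ-zero : ∀ (xs : List A) → ∑[ x ∈ xs ] 0 ≡ 0
∑ₗ-zero []       = refl
∑ₗ-zero (x ∷ xs) = ∑ₗ-zero xs

∑ₗ-cong : ∀ (xs : List A) {f g : A → ℕ} → (∀ x → f x ≡ g x) → ∑[ x ∈ xs ] f x ≡ ∑[ x ∈ xs ] g x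
∑ₗ-cong []       f≗g = refl
∑ₗ-cong (x ∷ xs) f≗g = cong₂ _+_ (f≗g x) (∑ₗ-cong xs f≗g)

∑ₗ-mono : ∀ (xs : List A) {f g : A → ℕ} → (∀ x → f x ≤ g x) → ∑[ x ∈ xs ] f x ≤ ∑[ x ∈ xs ] g x
∑ₗ-mono []       f≤g = z≤n
∑ₗ-mono (x ∷ xs) f≤g = +-mono-≤ (f≤g x) (∑ₗ-mono xs f≤g)

∑ₗ-distrib-+ : ∀ (xs : List A) (f g : A → ℕ) →
               ∑[ x ∈ xs ] (f x + g x) ≡ ∑[ x ∈ xs ] f x + ∑[ x ∈ xs ] g x
∑ₗ-distrib-+ []       f g = refl
∑ₗ-distrib-+ (x ∷ xs) f g = trans (cong (f x + g x +_) (∑ₗ-distrib-+ xs f g))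
                                  (interchange (f x) (g x) (∑ₗ xs f) (∑ₗ xs g))

*-distribˡ-∑ₗ : ∀ c (xs : List A) (f : A → ℕ) → c * ∑[ x ∈ xs ] f x ≡ ∑[ x ∈ xs ] (c * f x)
*-distribˡ-∑ₗ c []       f = *-zeroʳ c
*-distribˡ-∑ₗ c (x ∷ xs) f =
  trans (*-distribˡ-+ c (f x) (∑ₗ xs f)) (cong (c * f x +_) (*-distribˡ-∑ₗ c xs f))

*-distribʳ-∑ₗ : ∀ c (xs : List A) (f : A → ℕ) → (∑[ x ∈ xs ] f x) * c ≡ ∑[ x ∈ xs ] (f x * c)
*-distribʳ-∑ₗ c xs f =
  trans (*-comm (∑ₗ xs f) c) (trans (*-distribˡ-∑ₗ c xs f) (∑ₗ-cong xs (λ x → *-comm c (f x))))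

∑ₗ-const : ∀ (xs : List A) c → ∑[ x ∈ xs ] c ≡ length xs * c
∑ₗ-const []       c = refl
∑ₗ-const (x ∷ xs) c = cong (c +_) (∑ₗ-const xs c)

∑ₗ-++ : ∀ (xs ys : List A) (f : A → ℕ) → ∑[ x ∈ xs ++ ys ] f x ≡ ∑[ x ∈ xs ] f x + ∑[ y ∈ ys ] f y
∑ₗ-++ []       ys f = refl
∑ₗ-++ (x ∷ xs) ys f = trans (cong (f x +_) (∑ₗ-++ xs ys f)) (sym (+-assoc (f x) _ _))

∑ₗ-map : ∀ (g : A → B) (xs : List A) (f : B → ℕ) → ∑[ y ∈ map g xs ] f y ≡ ∑[ x ∈ xs ] f (g x)
∑ₗ-map g []       f = refl
∑ₗ-map g (x ∷ xs) f = cong (f (g x) +_) (∑ₗ-map g xs f)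

∑ₗ-concatMap : ∀ (g : A → List B) (xs : List A) (f : B → ℕ) →
               ∑[ y ∈ concatMap g xs ] f y ≡ ∑[ x ∈ xs ] ∑[ y ∈ g x ] f y
∑ₗ-concatMap g []       f = refl
∑ₗ-concatMap g (x ∷ xs) f =
  trans (∑ₗ-++ (g x) (concatMap g xs) f) (cong (∑ₗ (g x) f +_) (∑ₗ-concatMap g xs f))

∑ₗ-comm : ∀ (xs : List A) (ys : List B) (f : A → B → ℕ) →
          ∑[ x ∈ xs ] ∑[ y ∈ ys ] f x y ≡ ∑[ y ∈ ys ] ∑[ x ∈ xs ] f x y
∑ₗ-comm []       ys f = sym (∑ₗ-zero ys)
∑ₗ-comm (x ∷ xs) ys f =
  trans (cong (∑ₗ ys (f x) +_) (∑ₗ-comm xs ys f)) (sym (∑ₗ-distrib-+ ys (f x) _))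

∑ₗ-∑-comm : ∀ (xs : List A) (f : A → Fin n → ℕ) →
            ∑[ x ∈ xs ] ∑[ i < n ] f x i ≡ ∑[ i < n ] ∑[ x ∈ xs ] f x i
∑ₗ-∑-comm {n = n} []       f = sym (sum-replicate-zero n)
∑ₗ-∑-comm         (x ∷ xs) f =
  trans (cong (sum (f x) +_) (∑ₗ-∑-comm xs f)) (sym (∑-distrib-+ (f x) _))

∑ₗ-∑∑-comm : ∀ {m n} (xs : List A) (f : A → Fin m → Fin n → ℕ) →
             ∑[ x ∈ xs ] ∑[ i < m ] ∑[ j < n ] f x i j ≡ ∑[ i < m ] ∑[ j < n ] ∑[ x ∈ xs ] f x i j
∑ₗ-∑∑-comm {n = n} xs f =
  trans (∑ₗ-∑-comm xs (λ x i → ∑[ j < n ] f x i j)) (sum-cong-≗ (λ i → ∑ₗ-∑-comm xs (λ x → f x i)))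

∑ₗ-single : ∀ {xs : List A} {x} (f : A → ℕ) → x ∈ xs → f x ≤ ∑[ y ∈ xs ] f y
∑ₗ-single f (here refl)  = m≤m+n _ _
∑ₗ-single f (there x∈xs) = ≤-trans (∑ₗ-single f x∈xs) (m≤n+m _ _)

length-filter : ∀ (p : A → Bool) (xs : List A) → length (filter (T? ∘ p) xs) ≡ ∑[ x ∈ xs ] ind (p x)
length-filter p []       = refl
length-filter p (x ∷ xs) with p x
... | true  = cong suc (length-filter p xs)
... | false = length-filter p xs

∑-allFuns-suc : ∀ (xs : List A) n (F : (Fin (suc n) → A) → ℕ) →
                ∑[ f ∈ allFuns xs (suc n) ] F f ≡ ∑[ a ∈ xs ] ∑[ g ∈ allFuns xs n ] F (a ◂ g)
∑-allFuns-suc xs n F =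
  trans (∑ₗ-concatMap _ xs F) (∑ₗ-cong xs (λ a → ∑ₗ-map (a ◂_) (allFuns xs n) F))

∑-allFuns-const : ∀ (xs : List A) n c → ∑[ f ∈ allFuns xs n ] c ≡ length xs ^ n * c
∑-allFuns-const xs zero    c = refl
∑-allFuns-const xs (suc n) c = begin
  ∑[ f ∈ allFuns xs (suc n) ] c               ≡⟨ ∑-allFuns-suc xs n (λ _ → c) ⟩
  ∑[ a ∈ xs ] ∑[ g ∈ allFuns xs n ] c         ≡⟨ ∑ₗ-cong xs (λ _ → ∑-allFuns-const xs n c) ⟩
  ∑[ a ∈ xs ] (length xs ^ n * c)             ≡⟨ ∑ₗ-const xs _ ⟩
  length xs * (length xs ^ n * c)             ≡⟨ *-assoc (length xs) _ c ⟨
  length xs ^ suc n * c                       ∎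
  where open ≡-Reasoning

∑-tuples-const : ∀ m r c → ∑[ f ∈ allFuns (allFin m) r ] c ≡ m ^ r * c
∑-tuples-const m r c =
  trans (∑-allFuns-const (allFin m) r c) (cong (λ ℓ → ℓ ^ r * c) (length-tabulate id))

-- Without function extensionality a reindexed sum over allFuns matches the
-- original only up to pointwise equality of functions, hence the relation _≈_.
module _ {A : Set} (_≈_ : A → A → Set) (≈-refl : ∀ {a} → a ≈ a) where

  Respects≈ : ∀ {I : Set} → ((I → A) → ℕ) → Set
  Respects≈ F = ∀ {f g} → (∀ i → f i ≈ g i) → F f ≡ F g

  ◂-cong : ∀ {n a b} {f g : Fin n → A} → a ≈ b → (∀ i → f i ≈ g i) → ∀ i → (a ◂ f) i ≈ (b ◂ g) i
  ◂-cong a≈b f≈g Fin.zero    = a≈b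
  ◂-cong a≈b f≈g (Fin.suc i) = f≈g i

  ∑-allFuns-single : ∀ {xs : List A} {n} (F : (Fin n → A) → ℕ) → Respects≈ F →
                     ∀ f → (∀ i → f i ∈ xs) → F f ≤ ∑[ g ∈ allFuns xs n ] F g
  ∑-allFuns-single {n = zero}      F resp f f∈xs = ≤-trans (≤-reflexive (resp (λ ()))) (m≤m+n _ 0)
  ∑-allFuns-single {xs} {n = suc n} F resp f f∈xs = begin
    F f                                           ≡⟨ resp head-tail ⟩
    F (f Fin.zero ◂ f ∘ Fin.suc)                  ≤⟨ ∑-allFuns-single _ (resp ∘ ◂-cong ≈-refl)
                                                                      (f ∘ Fin.suc) (f∈xs ∘ Fin.suc) ⟩
    ∑[ g ∈ allFuns xs n ] F (f Fin.zero ◂ g)      ≤⟨ ∑ₗ-single (λ a → ∑ₗ (allFuns xs n) (F ∘ (a ◂_)))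
                                                               (f∈xs Fin.zero) ⟩
    ∑[ a ∈ xs ] ∑[ g ∈ allFuns xs n ] F (a ◂ g)   ≡⟨ ∑-allFuns-suc xs n F ⟨
    ∑[ g ∈ allFuns xs (suc n) ] F g               ∎
    where
    open ≤-Reasoning
    head-tail : ∀ i → f i ≈ (f Fin.zero ◂ f ∘ Fin.suc) i
    head-tail Fin.zero    = ≈-refl
    head-tail (Fin.suc i) = ≈-refl

  ∑-allFuns-map : ∀ (xs : List A) n (τ : Fin n → A → A) →
                  (∀ i (h : A → ℕ) → (∀ {a b} → a ≈ b → h a ≡ h b) →
                     ∑[ a ∈ xs ] h a ≡ ∑[ a ∈ xs ] h (τ i a)) →
                  (F : (Fin n → A) → ℕ) → Respects≈ F →
                  ∑[ f ∈ allFuns xs n ] F f ≡ ∑[ f ∈ allFuns xs n ] F (λ i → τ i (f i))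
  ∑-allFuns-map xs zero    τ τ-invariant F resp = cong (_+ 0) (resp (λ ()))
  ∑-allFuns-map xs (suc n) τ τ-invariant F resp = begin
    ∑[ f ∈ allFuns xs (suc n) ] F f
      ≡⟨ ∑-allFuns-suc xs n F ⟩
    ∑[ a ∈ xs ] ∑[ g ∈ allFuns xs n ] F (a ◂ g)
      ≡⟨ τ-invariant Fin.zero _ (λ a≈b → ∑ₗ-cong (allFuns xs n) (λ g → resp (◂-cong a≈b (λ _ → ≈-refl)))) ⟩
    ∑[ a ∈ xs ] ∑[ g ∈ allFuns xs n ] F (τ Fin.zero a ◂ g)
      ≡⟨ ∑ₗ-cong xs (λ a → ∑-allFuns-map xs n (τ ∘ Fin.suc) (τ-invariant ∘ Fin.suc) _ (resp ∘ ◂-cong ≈-refl)) ⟩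
    ∑[ a ∈ xs ] ∑[ g ∈ allFuns xs n ] F (τ Fin.zero a ◂ τ-tail g)
      ≡⟨ ∑ₗ-cong xs (λ a → ∑ₗ-cong (allFuns xs n) (λ g → resp (map-◂ a g))) ⟩
    ∑[ a ∈ xs ] ∑[ g ∈ allFuns xs n ] F (λ i → τ i ((a ◂ g) i))
      ≡⟨ ∑-allFuns-suc xs n (λ f → F (λ i → τ i (f i))) ⟨
    ∑[ f ∈ allFuns xs (suc n) ] F (λ i → τ i (f i))
      ∎
    where
    open ≡-Reasoning
    τ-tail : (Fin n → A) → Fin n → A
    τ-tail g i = τ (Fin.suc i) (g i)
    map-◂ : ∀ a g i → (τ Fin.zero a ◂ τ-tail g) i ≈ τ i ((a ◂ g) i)
    map-◂ a g Fin.zero    = ≈-refl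
    map-◂ a g (Fin.suc i) = ≈-refl

_⊕_ : ∀ {m} → BipGraph m → BipGraph m → BipGraph m
(G ⊕ M) x y = G x y xor M x y

_≐_ : ∀ {m} → BipGraph m → BipGraph m → Set
G ≐ G′ = ∀ x y → G x y ≡ G′ x y

∑-bipGraphs-⊕ : ∀ {m} (M : BipGraph m) (F : BipGraph m → ℕ) → (∀ {G G′} → G ≐ G′ → F G ≡ F G′) →
                ∑[ G ∈ allBipGraphs m ] F G ≡ ∑[ G ∈ allBipGraphs m ] F (G ⊕ M)
∑-bipGraphs-⊕ {m} M F resp =
  ∑-allFuns-map _≗_ (λ _ → refl) (allFuns bools m) m (λ x r y → r y xor M x y) row-invariant F resp
  where
  bools : List Bool
  bools = true ∷ false ∷ []
  xor-invariant : ∀ c (h : Bool → ℕ) → ∑[ b ∈ bools ] h b ≡ ∑[ b ∈ bools ] h (b xor c)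
  xor-invariant false h = refl
  xor-invariant true  h = x+[y+z]≡y+[x+z] (h true) (h false) 0
  row-invariant : ∀ x (h : (Fin m → Bool) → ℕ) → (∀ {r s} → r ≗ s → h r ≡ h s) →
                  ∑[ r ∈ allFuns bools m ] h r ≡ ∑[ r ∈ allFuns bools m ] h (λ y → r y xor M x y)
  row-invariant x h resp-h =
    ∑-allFuns-map _≡_ refl bools m (λ y b → b xor M x y) (λ y h′ _ → xor-invariant (M x y) h′) h resp-h

module Regular {Δ m : ℕ} {G : BipGraph m} (regular : T (isΔRegular Δ m G)) where

  row-count : ∀ x → count m (G x) ≡ Δ
  row-count x = ≡ᵇ⇒≡ _ Δ (allF-elim (proj₁ (to T-∧ regular)) x)

  column-count : ∀ y → count m (λ x → G x y) ≡ Δ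
  column-count y = ≡ᵇ⇒≡ _ Δ (allF-elim (proj₂ (to T-∧ regular)) y)

  row-degree : ∀ x → ∑[ y < m ] ind (G x y) ≡ Δ
  row-degree x = trans (sym (count≡∑ (G x))) (row-count x)

  column-degree : ∀ y → ∑[ x < m ] ind (G x y) ≡ Δ
  column-degree y = trans (sym (count≡∑ (λ x → G x y))) (column-count y)

  edge-count : ∑[ x < m ] ∑[ y < m ] ind (G x y) ≡ m * Δ
  edge-count = trans (sum-cong-≗ row-degree) (∑-const m Δ)

isΔRegular-cong : ∀ Δ m {G G′ : BipGraph m} →
                  (∀ x → count m (G x) ≡ count m (G′ x)) →
                  (∀ y → count m (λ x → G x y) ≡ count m (λ x → G′ x y)) →
                  isΔRegular Δ m G ≡ isΔRegular Δ m G′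
isΔRegular-cong Δ m rows columns =
  cong₂ _∧_ (allF-cong (cong (_≡ᵇ Δ) ∘ rows)) (allF-cong (cong (_≡ᵇ Δ) ∘ columns))
  where
  allF-cong : ∀ {p q : Fin m → Bool} → (∀ i → p i ≡ q i) → allF m p ≡ allF m q
  allF-cong p≗q = cong (_≡ᵇ 0) (count-cong (cong not ∘ p≗q))

Edge : ℕ → Set
Edge m = Fin m × Fin m

_≟ₑ_ : ∀ {r s} → DecidableEquality (Fin r × Fin s)
_≟ₑ_ = ≡-dec _≟_ _≟_

_∈ₑ?_ : ∀ {m} (e : Edge m) (H : List (Edge m)) → Dec (e ∈ H)
e ∈ₑ? H = any? (e ≟ₑ_) H

∑∑-∈-bound : ∀ {m} (H : List (Edge m)) → ∑[ a < m ] ∑[ b < m ] ind (does ((a , b) ∈ₑ? H)) ≤ length H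
∑∑-∈-bound {m} []            = ≤-reflexive (∑∑-zero {m} {m})
∑∑-∈-bound {m} ((p , q) ∷ H) = begin
  ∑[ a < m ] ∑[ b < m ] ind (does ((a , b) ∈ₑ? ((p , q) ∷ H)))
    ≤⟨ ∑∑-mono (λ a b → ind-∨ (does ((a , b) ≟ₑ (p , q))) _) ⟩
  ∑[ a < m ] ∑[ b < m ] (δ a b + ind (does ((a , b) ∈ₑ? H)))
    ≡⟨ ∑∑-distrib-+ δ (λ a b → ind (does ((a , b) ∈ₑ? H))) ⟩
  ∑[ a < m ] ∑[ b < m ] δ a b + ∑[ a < m ] ∑[ b < m ] ind (does ((a , b) ∈ₑ? H))
    ≤⟨ +-mono-≤ (≤-reflexive ∑∑δ≡1) (∑∑-∈-bound H) ⟩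
  1 + length H
    ∎
  where
  open ≤-Reasoning
  δ : Fin m → Fin m → ℕ
  δ a b = ind (does ((a , b) ≟ₑ (p , q)))
  δ-split : ∀ a b → δ a b ≡ ind (does (a ≟ p)) * ind (does (b ≟ q))
  δ-split a b with a ≟ p
  ... | yes refl = sym (+-identityʳ _)
  ... | no _     = refl
  ∑∑δ≡1 : ∑[ a < m ] ∑[ b < m ] δ a b ≡ 1
  ∑∑δ≡1 = begin-equality
    ∑[ a < m ] ∑[ b < m ] δ a b
      ≡⟨ sum-cong-≗ (λ a → sum-cong-≗ (δ-split a)) ⟩
    ∑[ a < m ] ∑[ b < m ] (ind (does (a ≟ p)) * ind (does (b ≟ q)))
      ≡⟨ ∑-*-∑ (λ a → ind (does (a ≟ p))) _ ⟩
    (∑[ a < m ] ind (does (a ≟ p))) * (∑[ b < m ] ind (does (b ≟ q)))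
      ≡⟨ cong₂ _*_ (∑-δ p) (∑-δ q) ⟩
    1 ∎

isRegularContaining : (Δ m : ℕ) → List (Edge m) → BipGraph m → Bool
isRegularContaining Δ m H G = isΔRegular Δ m G ∧ all (uncurry G) H

isRegularContaining-cong : ∀ Δ m H {G G′ : BipGraph m} → G ≐ G′ →
                           isRegularContaining Δ m H G ≡ isRegularContaining Δ m H G′
isRegularContaining-cong Δ m H G≐G′ =
  cong₂ _∧_ (isΔRegular-cong Δ m (λ x → count-cong (G≐G′ x)) (λ y → count-cong (λ x → G≐G′ x y)))
            (cong and (map-cong (λ (x , y) → G≐G′ x y) H))

numRegularContaining : (Δ m : ℕ) → List (Edge m) → ℕ
numRegularContaining Δ m H = ∑[ G ∈ allBipGraphs m ] ind (isRegularContaining Δ m H G)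

numRegular≡numRegularContaining[] : ∀ Δ m → numRegular Δ m ≡ numRegularContaining Δ m []
numRegular≡numRegularContaining[] Δ m =
  trans (length-filter (isΔRegular Δ m) (allBipGraphs m))
        (∑ₗ-cong (allBipGraphs m) (λ G → cong ind (sym (∧-identityʳ (isΔRegular Δ m G)))))

numRegularContaining-0 : ∀ m e (H : List (Edge m)) → numRegularContaining 0 m (e ∷ H) ≡ 0
numRegularContaining-0 m (u , v) H =
  n≤0⇒n≡0 (≤-trans (∑ₗ-mono (allBipGraphs m) (λ G → ind-mono (no-edge G)))
                   (≤-reflexive (∑ₗ-zero (allBipGraphs m))))
  where
  no-edge : ∀ G → T (isRegularContaining 0 m ((u , v) ∷ H) G) → T false
  no-edge G regular∧uv with to T-∧ regular∧uv
  ... | regular , uv∧H with G u v | count≡0 (Regular.row-count {G = G} regular u) v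
  ...   | true | ()

InRectangle : ∀ {m} (u a v b x y : Fin m) → Set
InRectangle u a v b x y = (x ≡ u ⊎ x ≡ a) × (y ≡ v ⊎ y ≡ b)

inRectangle? : ∀ {m} (u a v b x y : Fin m) → Dec (InRectangle u a v b x y)
inRectangle? u a v b x y = (x ≟ u ⊎-dec x ≟ a) ×-dec (y ≟ v ⊎-dec y ≟ b)

rectangle : ∀ {m} (u a v b : Fin m) → BipGraph m
rectangle u a v b x y = does (inRectangle? u a v b x y)

switch : ∀ {m} (u a v b : Fin m) → BipGraph m → BipGraph m
switch u a v b G = G ⊕ rectangle u a v b

module Switch {m} {G : BipGraph m} {u a v b : Fin m}
              (uv : G u v ≡ true) (ab : G a b ≡ true) (ub : G u b ≡ false) (av : G a v ≡ false) where

  private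
    G′ : BipGraph m
    G′ = switch u a v b G

  inside : ∀ {x y} → InRectangle u a v b x y → G′ x y ≡ not (G x y)
  inside {x} {y} ∈ =
    trans (cong (G x y xor_) (dec-true (inRectangle? u a v b x y) ∈)) (xor-comm (G x y) true)

  outside : ∀ {x y} → ¬ InRectangle u a v b x y → G′ x y ≡ G x y
  outside {x} {y} ∉ =
    trans (cong (G x y xor_) (dec-false (inRectangle? u a v b x y) ∉)) (xor-identityʳ (G x y))

  outside-row : ∀ {x y} → x ≢ u → x ≢ a → G′ x y ≡ G x y
  outside-row x≢u x≢a = outside ([ x≢u , x≢a ] ∘ proj₁)

  outside-column : ∀ {x y} → y ≢ v → y ≢ b → G′ x y ≡ G x y
  outside-column y≢v y≢b = outside ([ y≢v , y≢b ] ∘ proj₂)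

  switched-uv : G′ u v ≡ false
  switched-uv = trans (inside (inj₁ refl , inj₁ refl)) (cong not uv)

  switched-ub : G′ u b ≡ true
  switched-ub = trans (inside (inj₁ refl , inj₂ refl)) (cong not ub)

  switched-av : G′ a v ≡ true
  switched-av = trans (inside (inj₂ refl , inj₁ refl)) (cong not av)

  switched-ab : G′ a b ≡ false
  switched-ab = trans (inside (inj₂ refl , inj₂ refl)) (cong not ab)

  row-count-preserved : ∀ x → count m (G x) ≡ count m (G′ x)
  row-count-preserved x = by-cases (x ≟ u) (x ≟ a)
    where
    by-cases : Dec (x ≡ u) → Dec (x ≡ a) → count m (G x) ≡ count m (G′ x)
    by-cases (yes refl) _          =
      count-exchange v b (trans uv (sym switched-ub)) (trans ub (sym switched-uv))
                     (λ _ ≢v ≢b → sym (outside-column {x = x} ≢v ≢b))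
    by-cases (no _)     (yes refl) =
      count-exchange v b (trans av (sym switched-ab)) (trans ab (sym switched-av))
                     (λ _ ≢v ≢b → sym (outside-column {x = x} ≢v ≢b))
    by-cases (no x≢u)   (no x≢a)   = count-cong (λ y → sym (outside-row {y = y} x≢u x≢a))

  column-count-preserved : ∀ y → count m (λ x → G x y) ≡ count m (λ x → G′ x y)
  column-count-preserved y = by-cases (y ≟ v) (y ≟ b)
    where
    by-cases : Dec (y ≡ v) → Dec (y ≡ b) → count m (λ x → G x y) ≡ count m (λ x → G′ x y)
    by-cases (yes refl) _          =
      count-exchange u a (trans uv (sym switched-av)) (trans av (sym switched-uv))
                     (λ _ ≢u ≢a → sym (outside-row {y = y} ≢u ≢a))
    by-cases (no _)     (yes refl) =
      count-exchange u a (trans ub (sym switched-ab)) (trans ab (sym switched-ub))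
                     (λ _ ≢u ≢a → sym (outside-row {y = y} ≢u ≢a))
    by-cases (no y≢v)   (no y≢b)   = count-cong (λ x → sym (outside-column {x = x} y≢v y≢b))

  switch-preserves-regularity : ∀ Δ → isΔRegular Δ m G′ ≡ isΔRegular Δ m G
  switch-preserves-regularity Δ =
    sym (isΔRegular-cong Δ m row-count-preserved column-count-preserved)

  switch-keeps-edge : ∀ {p q} → T (G p q) → (u , v) ≢ (p , q) → (a , b) ≢ (p , q) → T (G′ p q)
  switch-keeps-edge {p} {q} pq ≢uv ≢ab = by-cases (p ≟ u) (p ≟ a) (q ≟ v) (q ≟ b)
    where
    by-cases : Dec (p ≡ u) → Dec (p ≡ a) → Dec (q ≡ v) → Dec (q ≡ b) → T (G′ p q)
    by-cases (yes refl) _          (yes refl) _          = ⊥-elim (≢uv refl)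
    by-cases _          (yes refl) _          (yes refl) = ⊥-elim (≢ab refl)
    by-cases (yes refl) _          _          (yes refl) = ⊥-elim (subst T ub pq)
    by-cases _          (yes refl) (yes refl) _          = ⊥-elim (subst T av pq)
    by-cases (no p≢u)   (no p≢a)   _          _          = subst T (sym (outside-row p≢u p≢a)) pq
    by-cases _          _          (no q≢v)   (no q≢b)   = subst T (sym (outside-column q≢v q≢b)) pq

  switch-keeps-edges : ∀ {H} → All (T ∘ uncurry G) H → ¬ (u , v) ∈ H → ¬ (a , b) ∈ H →
                       All (T ∘ uncurry G′) H
  switch-keeps-edges edges uv∉H ab∉H = All.tabulate λ { {p , q} e∈H →
    switch-keeps-edge (All.lookup edges e∈H) (λ { refl → uv∉H e∈H }) (λ { refl → ab∉H e∈H }) }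

edge-blocked-or-switchable : ∀ e y z w →
  ind e ≤ ind (e ∧ not y ∧ not z ∧ not w) + (ind (y ∧ e) + (ind (z ∧ e) + ind w))
edge-blocked-or-switchable false _     _     _     = z≤n
edge-blocked-or-switchable true  true  _     _     = s≤s z≤n
edge-blocked-or-switchable true  false true  _     = s≤s z≤n
edge-blocked-or-switchable true  false false true  = s≤s z≤n
edge-blocked-or-switchable true  false false false = s≤s z≤n

module SwitchingCount (Δ m : ℕ) (u v : Fin m) (H : List (Edge m)) where

  switchable : BipGraph m → Fin m → Fin m → Bool
  switchable G a b = G a b ∧ not (G u b) ∧ not (G a v) ∧ not (does ((a , b) ∈ₑ? H))

  module _ {G : BipGraph m} (regular : T (isΔRegular Δ m G)) where

    open Regular {Δ} {m} {G} regular

    paths-via-column : ∑[ a < m ] ∑[ b < m ] ind (G u b ∧ G a b) ≡ Δ * Δ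
    paths-via-column = begin
      ∑[ a < m ] ∑[ b < m ] ind (G u b ∧ G a b)
        ≡⟨ sum-cong-≗ (λ a → sum-cong-≗ (λ b → ind-∧ (G u b) (G a b))) ⟩
      ∑[ a < m ] ∑[ b < m ] (ind (G u b) * ind (G a b))
        ≡⟨ ∑-comm (λ a b → ind (G u b) * ind (G a b)) ⟩
      ∑[ b < m ] ∑[ a < m ] (ind (G u b) * ind (G a b))
        ≡⟨ sum-cong-≗ (λ b → *-distribˡ-sum (ind (G u b)) (λ a → ind (G a b))) ⟨
      ∑[ b < m ] (ind (G u b) * ∑[ a < m ] ind (G a b))
        ≡⟨ sum-cong-≗ (λ b → cong (ind (G u b) *_) (column-degree b)) ⟩
      ∑[ b < m ] (ind (G u b) * Δ)
        ≡⟨ *-distribʳ-sum Δ (λ b → ind (G u b)) ⟨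
      (∑[ b < m ] ind (G u b)) * Δ
        ≡⟨ cong (_* Δ) (row-degree u) ⟩
      Δ * Δ
        ∎
      where open ≡-Reasoning

    paths-via-row : ∑[ a < m ] ∑[ b < m ] ind (G a v ∧ G a b) ≡ Δ * Δ
    paths-via-row = begin
      ∑[ a < m ] ∑[ b < m ] ind (G a v ∧ G a b)
        ≡⟨ sum-cong-≗ (λ a → sum-cong-≗ (λ b → ind-∧ (G a v) (G a b))) ⟩
      ∑[ a < m ] ∑[ b < m ] (ind (G a v) * ind (G a b))
        ≡⟨ sum-cong-≗ (λ a → *-distribˡ-sum (ind (G a v)) (λ b → ind (G a b))) ⟨
      ∑[ a < m ] (ind (G a v) * ∑[ b < m ] ind (G a b))
        ≡⟨ sum-cong-≗ (λ a → cong (ind (G a v) *_) (row-degree a)) ⟩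
      ∑[ a < m ] (ind (G a v) * Δ)
        ≡⟨ *-distribʳ-sum Δ (λ a → ind (G a v)) ⟨
      (∑[ a < m ] ind (G a v)) * Δ
        ≡⟨ cong (_* Δ) (column-degree v) ⟩
      Δ * Δ
        ∎
      where open ≡-Reasoning

    switchable-lower-bound :
      m * Δ ≤ ∑[ a < m ] ∑[ b < m ] ind (switchable G a b) + (Δ * Δ + (Δ * Δ + length H))
    switchable-lower-bound = begin
      m * Δ
        ≡⟨ edge-count ⟨
      ∑[ a < m ] ∑[ b < m ] ind (G a b)
        ≤⟨ ∑∑-mono (λ a b → edge-blocked-or-switchable (G a b) (G u b) (G a v) (does ((a , b) ∈ₑ? H))) ⟩
      ∑[ a < m ] ∑[ b < m ] (sw a b + (p₁ a b + (p₂ a b + e a b)))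
        ≡⟨ trans (∑∑-distrib-+ sw _) (cong (∑∑ sw +_)
             (trans (∑∑-distrib-+ p₁ _) (cong (∑∑ p₁ +_) (∑∑-distrib-+ p₂ e)))) ⟩
      ∑∑ sw + (∑∑ p₁ + (∑∑ p₂ + ∑∑ e))
        ≤⟨ +-monoʳ-≤ (∑∑ sw) (+-mono-≤ (≤-reflexive paths-via-column)
                               (+-mono-≤ (≤-reflexive paths-via-row) (∑∑-∈-bound H))) ⟩
      ∑∑ sw + (Δ * Δ + (Δ * Δ + length H))
        ∎
      where
      open ≤-Reasoning
      ∑∑ : (Fin m → Fin m → ℕ) → ℕ
      ∑∑ f = ∑[ a < m ] ∑[ b < m ] f a b
      sw p₁ p₂ e : Fin m → Fin m → ℕ
      sw a b = ind (switchable G a b)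
      p₁ a b = ind (G u b ∧ G a b)
      p₂ a b = ind (G a v ∧ G a b)
      e  a b = ind (does ((a , b) ∈ₑ? H))

    reverse-switchable-count : ∑[ a < m ] ∑[ b < m ] ind (G u b ∧ G a v) ≡ Δ * Δ
    reverse-switchable-count = begin
      ∑[ a < m ] ∑[ b < m ] ind (G u b ∧ G a v)
        ≡⟨ sum-cong-≗ (λ a → sum-cong-≗ (λ b → trans (ind-∧ (G u b) (G a v)) (*-comm (ind (G u b)) _))) ⟩
      ∑[ a < m ] ∑[ b < m ] (ind (G a v) * ind (G u b))
        ≡⟨ ∑-*-∑ (λ a → ind (G a v)) (λ b → ind (G u b)) ⟩
      (∑[ a < m ] ind (G a v)) * (∑[ b < m ] ind (G u b))
        ≡⟨ cong₂ _*_ (column-degree v) (row-degree u) ⟩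
      Δ * Δ
        ∎
      where open ≡-Reasoning

  switch-injects : ¬ (u , v) ∈ H → ∀ G a b →
                   T (isRegularContaining Δ m ((u , v) ∷ H) G ∧ switchable G a b) →
                   T (isRegularContaining Δ m H (switch u a v b G) ∧ (switch u a v b G u b ∧ switch u a v b G a v))
  switch-injects uv∉H G a b forward =
    let regular∧uvH , switchable-ab = to T-∧ forward
        regular , uvH               = to T-∧ regular∧uvH
        uv , H-edges                = to T-∧ uvH
        ab , ¬ub∧¬av∧ab∉H           = to T-∧ switchable-ab
        ¬ub , ¬av∧ab∉H              = to T-∧ ¬ub∧¬av∧ab∉H
        ¬av , ab∉H                  = to T-∧ ¬av∧ab∉H
        open Switch {G = G} {u} {a} {v} {b} (to T-≡ uv) (to T-≡ ab) (to T-not-≡ ¬ub) (to T-not-≡ ¬av)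
    in from T-∧ ( from T-∧ ( subst T (sym (switch-preserves-regularity Δ)) regular
                           , all⁻ _ (switch-keeps-edges (all⁺ _ H H-edges) uv∉H
                                                        (does-false ((a , b) ∈ₑ? H) ab∉H)))
                , from T-∧ (from T-≡ switched-ub , from T-≡ switched-av))

  private
    N⁺ N : ℕ
    N⁺ = numRegularContaining Δ m ((u , v) ∷ H)
    N  = numRegularContaining Δ m H

    forward backward : BipGraph m → Fin m → Fin m → Bool
    forward  G a b = isRegularContaining Δ m ((u , v) ∷ H) G ∧ switchable G a b
    backward G a b = isRegularContaining Δ m H G ∧ (G u b ∧ G a v)

  #forward : ℕ
  #forward = ∑[ G ∈ allBipGraphs m ] ∑[ a < m ] ∑[ b < m ] ind (forward G a b)

  forward-count : N⁺ * (m * Δ) ≤ #forward + N⁺ * (Δ * Δ + (Δ * Δ + length H))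
  forward-count = begin
    N⁺ * (m * Δ)
      ≡⟨ *-distribʳ-∑ₗ (m * Δ) (allBipGraphs m) _ ⟩
    ∑[ G ∈ allBipGraphs m ] (ind (with-uv G) * (m * Δ))
      ≤⟨ ∑ₗ-mono (allBipGraphs m) per-graph ⟩
    ∑[ G ∈ allBipGraphs m ] (∑[ a < m ] ∑[ b < m ] ind (forward G a b) + ind (with-uv G) * K)
      ≡⟨ ∑ₗ-distrib-+ (allBipGraphs m) _ _ ⟩
    #forward + ∑[ G ∈ allBipGraphs m ] (ind (with-uv G) * K)
      ≡⟨ cong (#forward +_) (*-distribʳ-∑ₗ K (allBipGraphs m) _) ⟨
    #forward + N⁺ * K
      ∎
    where
    open ≤-Reasoning
    K : ℕ
    K = Δ * Δ + (Δ * Δ + length H)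
    with-uv : BipGraph m → Bool
    with-uv = isRegularContaining Δ m ((u , v) ∷ H)
    per-graph : ∀ G → ind (with-uv G) * (m * Δ)
                        ≤ ∑[ a < m ] ∑[ b < m ] ind (with-uv G ∧ switchable G a b) + ind (with-uv G) * K
    per-graph G with with-uv G in eq
    ... | false = z≤n
    ... | true  = subst₂ _≤_ (sym (*-identityˡ (m * Δ)))
                             (cong (∑[ a < m ] ∑[ b < m ] ind (switchable G a b) +_) (sym (*-identityˡ K)))
                             (switchable-lower-bound (proj₁ (to T-∧ (from T-≡ eq))))

  backward-count : ¬ (u , v) ∈ H → #forward ≤ N * (Δ * Δ)
  backward-count uv∉H = begin
    #forward
      ≡⟨ ∑ₗ-∑∑-comm (allBipGraphs m) (λ G a b → ind (forward G a b)) ⟩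
    ∑[ a < m ] ∑[ b < m ] ∑[ G ∈ allBipGraphs m ] ind (forward G a b)
      ≤⟨ ∑∑-mono (λ a b → ∑ₗ-mono (allBipGraphs m) (λ G → ind-mono (switch-injects uv∉H G a b))) ⟩
    ∑[ a < m ] ∑[ b < m ] ∑[ G ∈ allBipGraphs m ] ind (backward (switch u a v b G) a b)
      ≡⟨ sum-cong-≗ (λ a → sum-cong-≗ (λ b →
           ∑-bipGraphs-⊕ (rectangle u a v b) (λ G → ind (backward G a b)) (backward-cong a b))) ⟨
    ∑[ a < m ] ∑[ b < m ] ∑[ G ∈ allBipGraphs m ] ind (backward G a b)
      ≡⟨ ∑ₗ-∑∑-comm (allBipGraphs m) (λ G a b → ind (backward G a b)) ⟨
    ∑[ G ∈ allBipGraphs m ] ∑[ a < m ] ∑[ b < m ] ind (backward G a b)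
      ≡⟨ ∑ₗ-cong (allBipGraphs m) per-graph ⟩
    ∑[ G ∈ allBipGraphs m ] (ind (isRegularContaining Δ m H G) * (Δ * Δ))
      ≡⟨ *-distribʳ-∑ₗ (Δ * Δ) (allBipGraphs m) _ ⟨
    N * (Δ * Δ)
      ∎
    where
    open ≤-Reasoning
    backward-cong : ∀ a b {G G′} → G ≐ G′ → ind (backward G a b) ≡ ind (backward G′ a b)
    backward-cong a b G≐G′ =
      cong ind (cong₂ _∧_ (isRegularContaining-cong Δ m H G≐G′) (cong₂ _∧_ (G≐G′ u b) (G≐G′ a v)))
    per-graph : ∀ G → ∑[ a < m ] ∑[ b < m ] ind (backward G a b) ≡ ind (isRegularContaining Δ m H G) * (Δ * Δ)
    per-graph G with isRegularContaining Δ m H G in eq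
    ... | false = ∑∑-zero {m} {m}
    ... | true  = trans (reverse-switchable-count (proj₁ (to T-∧ (from T-≡ eq)))) (sym (*-identityˡ (Δ * Δ)))

switching-arithmetic : ∀ {N⁺ N S m Δ h} .{{_ : NonZero Δ}} →
                       N⁺ * (m * Δ) ≤ S + N⁺ * (Δ * Δ + (Δ * Δ + h)) → S ≤ N * (Δ * Δ) →
                       4 * Δ + 2 * h ≤ m → m * N⁺ ≤ 2 * Δ * N
switching-arithmetic {N⁺} {N} {S} {m} {Δ} {h} forward backward m-large =
  +-cancelʳ-≤ (m * N⁺) (m * N⁺) (2 * Δ * N) (begin
    m * N⁺ + m * N⁺                                           ≡⟨ cong₂ _+_ (*-comm m N⁺) (*-comm m N⁺) ⟩
    N⁺ * m + N⁺ * m                                           ≤⟨ +-mono-≤ divided divided ⟩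
    (N * Δ + N⁺ * (2 * Δ + h)) + (N * Δ + N⁺ * (2 * Δ + h))   ≡⟨ doubled N N⁺ Δ h ⟩
    2 * Δ * N + N⁺ * (4 * Δ + 2 * h)                          ≤⟨ +-monoʳ-≤ (2 * Δ * N) (*-monoʳ-≤ N⁺ m-large) ⟩
    2 * Δ * N + N⁺ * m                                        ≡⟨ cong (2 * Δ * N +_) (*-comm N⁺ m) ⟩
    2 * Δ * N + m * N⁺                                        ∎)
  where
  open ≤-Reasoning
  factored : ∀ N N⁺ Δ h → N * (Δ * Δ) + N⁺ * (Δ * Δ + (Δ * Δ + h * Δ)) ≡ (N * Δ + N⁺ * (2 * Δ + h)) * Δ
  factored = solve-∀
  doubled : ∀ N N⁺ Δ h → (N * Δ + N⁺ * (2 * Δ + h)) + (N * Δ + N⁺ * (2 * Δ + h))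
                           ≡ 2 * Δ * N + N⁺ * (4 * Δ + 2 * h)
  doubled = solve-∀
  divided : N⁺ * m ≤ N * Δ + N⁺ * (2 * Δ + h)
  divided = *-cancelʳ-≤ _ _ Δ (begin
    N⁺ * m * Δ                                     ≡⟨ *-assoc N⁺ m Δ ⟩
    N⁺ * (m * Δ)                                   ≤⟨ forward ⟩
    S + N⁺ * (Δ * Δ + (Δ * Δ + h))                 ≤⟨ +-mono-≤ backward (*-monoʳ-≤ N⁺
                                                        (+-monoʳ-≤ (Δ * Δ) (+-monoʳ-≤ (Δ * Δ) (m≤m*n h Δ)))) ⟩
    N * (Δ * Δ) + N⁺ * (Δ * Δ + (Δ * Δ + h * Δ))   ≡⟨ factored N N⁺ Δ h ⟩
    (N * Δ + N⁺ * (2 * Δ + h)) * Δ                 ∎)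

switching-step : ∀ Δ m u v (H : List (Edge m)) → ¬ (u , v) ∈ H → 4 * Δ + 2 * length H ≤ m →
                 m * numRegularContaining Δ m ((u , v) ∷ H) ≤ 2 * Δ * numRegularContaining Δ m H
switching-step zero      m u v H _ _ =
  ≤-reflexive (trans (cong (m *_) (numRegularContaining-0 m (u , v) H)) (*-zeroʳ m))
switching-step Δ@(suc _) m u v H uv∉H m-large =
  switching-arithmetic forward-count (backward-count uv∉H) m-large
  where open SwitchingCount Δ m u v H

iterated-switching : ∀ Δ m (H : List (Edge m)) → Unique H → 4 * Δ + 2 * length H ≤ m →
                     m ^ length H * numRegularContaining Δ m H
                       ≤ (2 * Δ) ^ length H * numRegularContaining Δ m []
iterated-switching Δ m []            _                 _       = ≤-refl
iterated-switching Δ m ((u , v) ∷ H) (uv∉H ∷ H-unique) m-large = begin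
  m ^ suc h * N⁺                ≡⟨ trans (*-assoc m (m ^ h) N⁺) (x*[y*z]≡y*[x*z] m (m ^ h) N⁺) ⟩
  m ^ h * (m * N⁺)              ≤⟨ *-monoʳ-≤ (m ^ h) (switching-step Δ m u v H (All¬⇒¬Any uv∉H) m-large′) ⟩
  m ^ h * (2 * Δ * N)           ≡⟨ x*[y*z]≡y*[x*z] (m ^ h) (2 * Δ) N ⟩
  2 * Δ * (m ^ h * N)           ≤⟨ *-monoʳ-≤ (2 * Δ) (iterated-switching Δ m H H-unique m-large′) ⟩
  2 * Δ * ((2 * Δ) ^ h * N₀)    ≡⟨ *-assoc (2 * Δ) ((2 * Δ) ^ h) N₀ ⟨
  (2 * Δ) ^ suc h * N₀          ∎
  where
  open ≤-Reasoning
  h N⁺ N N₀ : ℕ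
  h  = length H
  N⁺ = numRegularContaining Δ m ((u , v) ∷ H)
  N  = numRegularContaining Δ m H
  N₀ = numRegularContaining Δ m []
  m-large′ : 4 * Δ + 2 * h ≤ m
  m-large′ = ≤-trans (+-monoʳ-≤ (4 * Δ) (*-monoʳ-≤ 2 (n≤1+n h))) m-large

Pattern : ℕ → ℕ → Set
Pattern r s = List (Fin r × Fin s)

unique? : ∀ {r s} (H : List (Fin r × Fin s)) → Dec (Unique H)
unique? = UniqueDec.unique? _≟ₑ_

embed : ∀ {m r s} → (Fin r → Fin m) → (Fin s → Fin m) → Pattern r s → List (Edge m)
embed f g = map (λ (i , j) → f i , g j)

-- Only maps whose image edges are pairwise distinct count as copies, since
-- the switching bound is for lists of distinct edges.
isCopy : ∀ {m r s} → Pattern r s → BipGraph m → (Fin r → Fin m) → (Fin s → Fin m) → Bool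
isCopy P G f g = does (unique? (embed f g P)) ∧ all (uncurry G) (embed f g P)

copies : ∀ m {r s} → Pattern r s → BipGraph m → ℕ
copies m {r} {s} P G = ∑[ f ∈ allFuns (allFin m) r ] ∑[ g ∈ allFuns (allFin m) s ] ind (isCopy P G f g)

isCopy-cong : ∀ {m r s} (P : Pattern r s) (G : BipGraph m) {f f′ g g′} → f ≗ f′ → g ≗ g′ →
              isCopy P G f g ≡ isCopy P G f′ g′
isCopy-cong P G f≗f′ g≗g′ =
  cong (λ H → does (unique? H) ∧ all (uncurry G) H) (map-cong (λ (i , j) → cong₂ _,_ (f≗f′ i) (g≗g′ j)) P)

copy-found : ∀ {m r s} (P : Pattern r s) (G : BipGraph m) {f g} → Unique P →
             Injective _≡_ _≡_ f → Injective _≡_ _≡_ g → All (T ∘ uncurry G) (embed f g P) →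
             1 ≤ copies m P G
copy-found {m} {r} {s} P G {f} {g} P-unique f-injective g-injective edges = begin
  1
    ≤⟨ ind-mono (λ _ → is-copy) ⟩
  ind (isCopy P G f g)
    ≤⟨ ∑-allFuns-single _≡_ refl (ind ∘ isCopy P G f) (cong ind ∘ isCopy-cong P G (λ _ → refl)) g (∈-allFin ∘ g) ⟩
  ∑[ g′ ∈ allFuns (allFin m) s ] ind (isCopy P G f g′)
    ≤⟨ ∑-allFuns-single _≡_ refl (λ f′ → ∑ₗ (allFuns (allFin m) s) (ind ∘ isCopy P G f′))
         (λ f≗f′ → ∑ₗ-cong (allFuns (allFin m) s) (λ g′ → cong ind (isCopy-cong P G {g = g′} f≗f′ (λ _ → refl))))
         f (∈-allFin ∘ f) ⟩
  copies m P G
    ∎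
  where
  open ≤-Reasoning
  embedding-injective : Injective _≡_ _≡_ (λ ((i , j) : Fin r × Fin s) → f i , g j)
  embedding-injective eq = cong₂ _,_ (f-injective (cong proj₁ eq)) (g-injective (cong proj₂ eq))
  is-copy : T (isCopy P G f g)
  is-copy = from T-∧ ( from T-≡ (dec-true (unique? (embed f g P)) (Uniqueₚ.map⁺ embedding-injective P-unique))
                     , all⁻ _ edges)

embedding-bound : ∀ Δ m {r s} (P : Pattern r s) → 4 * Δ + 2 * length P ≤ m → ∀ f g →
                  m ^ length P * ∑[ G ∈ allBipGraphs m ] (ind (isΔRegular Δ m G) * ind (isCopy P G f g))
                    ≤ (2 * Δ) ^ length P * numRegularContaining Δ m []
embedding-bound Δ m P m-large f g = begin
  m ^ e * ∑[ G ∈ allBipGraphs m ] (ind (isΔRegular Δ m G) * ind (isCopy P G f g))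
    ≡⟨ cong (m ^ e *_) (∑ₗ-cong (allBipGraphs m) (λ G → ind-∧-exchange (isΔRegular Δ m G) (does (unique? H)) _)) ⟩
  m ^ e * ∑[ G ∈ allBipGraphs m ] (ind (does (unique? H)) * ind (isRegularContaining Δ m H G))
    ≡⟨ cong (m ^ e *_) (*-distribˡ-∑ₗ (ind (does (unique? H))) (allBipGraphs m) _) ⟨
  m ^ e * (ind (does (unique? H)) * numRegularContaining Δ m H)
    ≤⟨ by-uniqueness (unique? H) ⟩
  (2 * Δ) ^ e * numRegularContaining Δ m []
    ∎
  where
  open ≤-Reasoning
  H : List (Edge m)
  H = embed f g P
  e : ℕ
  e = length P
  by-uniqueness : (d : Dec (Unique H)) →
                  m ^ e * (ind (does d) * numRegularContaining Δ m H) ≤ (2 * Δ) ^ e * numRegularContaining Δ m []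
  by-uniqueness (no _)         = ≤-trans (≤-reflexive (*-zeroʳ (m ^ e))) z≤n
  by-uniqueness (yes H-unique) =
    ≤-trans (≤-reflexive (cong (m ^ e *_) (*-identityˡ _)))
            (subst (λ ℓ → m ^ ℓ * numRegularContaining Δ m H ≤ (2 * Δ) ^ ℓ * numRegularContaining Δ m [])
                   (length-map _ P)
                   (iterated-switching Δ m H H-unique
                      (subst (λ ℓ → 4 * Δ + 2 * ℓ ≤ m) (sym (length-map _ P)) m-large)))

copies-bound : ∀ Δ m {r s} (P : Pattern r s) → 4 * Δ + 2 * length P ≤ m →
               m ^ length P * ∑[ G ∈ allBipGraphs m ] (ind (isΔRegular Δ m G) * copies m P G)
                 ≤ m ^ r * (m ^ s * ((2 * Δ) ^ length P * numRegularContaining Δ m []))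
copies-bound Δ m {r} {s} P m-large = begin
  m ^ e * ∑[ G ∈ Gs ] (ind (reg G) * copies m P G)
    ≡⟨ cong (m ^ e *_) (∑ₗ-cong Gs (λ G → trans (*-distribˡ-∑ₗ (ind (reg G)) (Fs r) _)
                                                (∑ₗ-cong (Fs r) (λ f → *-distribˡ-∑ₗ (ind (reg G)) (Fs s) _)))) ⟩
  m ^ e * ∑[ G ∈ Gs ] ∑[ f ∈ Fs r ] ∑[ g ∈ Fs s ] (ind (reg G) * ind (isCopy P G f g))
    ≡⟨ cong (m ^ e *_) (trans (∑ₗ-comm Gs (Fs r) _) (∑ₗ-cong (Fs r) (λ f → ∑ₗ-comm Gs (Fs s) _))) ⟩
  m ^ e * ∑[ f ∈ Fs r ] ∑[ g ∈ Fs s ] ∑[ G ∈ Gs ] (ind (reg G) * ind (isCopy P G f g))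
    ≡⟨ trans (*-distribˡ-∑ₗ (m ^ e) (Fs r) _) (∑ₗ-cong (Fs r) (λ f → *-distribˡ-∑ₗ (m ^ e) (Fs s) _)) ⟩
  ∑[ f ∈ Fs r ] ∑[ g ∈ Fs s ] (m ^ e * ∑[ G ∈ Gs ] (ind (reg G) * ind (isCopy P G f g)))
    ≤⟨ ∑ₗ-mono (Fs r) (λ f → ∑ₗ-mono (Fs s) (embedding-bound Δ m P m-large f)) ⟩
  ∑[ f ∈ Fs r ] ∑[ g ∈ Fs s ] target
    ≡⟨ trans (∑ₗ-cong (Fs r) (λ _ → ∑-tuples-const m s target)) (∑-tuples-const m r _) ⟩
  m ^ r * (m ^ s * target)
    ∎
  where
  open ≤-Reasoning
  e target : ℕ
  e = length P
  target = (2 * Δ) ^ e * numRegularContaining Δ m []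
  Gs : List (BipGraph m)
  Gs = allBipGraphs m
  Fs : (n : ℕ) → List (Fin n → Fin m)
  Fs = allFuns (allFin m)
  reg : BipGraph m → Bool
  reg = isΔRegular Δ m

excess-one-bound : ∀ Δ m {r s} (P : Pattern r s) → length P ≡ suc (r + s) → 4 * Δ + 2 * length P ≤ m →
                   m * ∑[ G ∈ allBipGraphs m ] (ind (isΔRegular Δ m G) * copies m P G)
                     ≤ (2 * Δ) ^ length P * numRegular Δ m
excess-one-bound Δ m {r} {s} P ∣P∣≡ m-large = *-cancelˡ-≤ (m ^ (r + s)) {{m^n≢0 m (r + s)}} (begin
  m ^ (r + s) * (m * X)                                  ≡⟨ x*[y*z]≡y*[x*z] (m ^ (r + s)) m X ⟩
  m * (m ^ (r + s) * X)                                  ≡⟨ *-assoc m (m ^ (r + s)) X ⟨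
  m ^ suc (r + s) * X                                    ≡⟨ cong (λ ℓ → m ^ ℓ * X) ∣P∣≡ ⟨
  m ^ length P * X                                       ≤⟨ copies-bound Δ m P m-large ⟩
  m ^ r * (m ^ s * (C * numRegularContaining Δ m []))    ≡⟨ *-assoc (m ^ r) (m ^ s) _ ⟨
  m ^ r * m ^ s * (C * numRegularContaining Δ m [])      ≡⟨ cong₂ (λ M N → M * (C * N)) (^-distribˡ-+-* m r s)
                                                                 (numRegular≡numRegularContaining[] Δ m) ⟨
  m ^ (r + s) * (C * numRegular Δ m)                     ∎)
  where
  open ≤-Reasoning
  X C : ℕ
  X = ∑[ G ∈ allBipGraphs m ] (ind (isΔRegular Δ m G) * copies m P G)
  C = (2 * Δ) ^ length P
  instance
    m≢0 : NonZero m
    m≢0 = >-nonZero (≤-trans (subst (λ ℓ → 1 ≤ 2 * ℓ) (sym ∣P∣≡) (s≤s z≤n)) (≤-trans (m≤n+m _ (4 * Δ)) m-large))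

record SharesPair {m} (G : BipGraph m) (x x′ y y′ : Fin m) : Set where
  constructor sharing
  field
    y≢y′ : y ≢ y′
    xy   : T (G x y)
    x′y  : T (G x′ y)
    xy′  : T (G x y′)
    x′y′ : T (G x′ y′)

SharesPair-swap : ∀ {m} {G : BipGraph m} {x x′ y y′} → SharesPair G x x′ y y′ → SharesPair G x x′ y′ y
SharesPair-swap (sharing y≢y′ xy x′y xy′ x′y′) = sharing (≢-sym y≢y′) xy′ x′y′ xy x′y

shares-pair : ∀ {m} (G : BipGraph m) x x′ → T (not ⌊ x ≟ x′ ⌋ ∧ (2 ≤ᵇ codeg m G x x′)) →
              x ≢ x′ × ∃[ y ] ∃[ y′ ] SharesPair G x x′ y y′
shares-pair {m} G x x′ partner =
  let distinct , two-common                = to T-∧ partner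
      y , y′ , y≢y′ , common-y , common-y′ = count-witness₂ (≤ᵇ⇒≤ 2 (codeg m G x x′) two-common)
      xy , x′y                             = to T-∧ common-y
      xy′ , x′y′                           = to T-∧ common-y′
  in does-false (x ≟ x′) (subst (T ∘ not) (isYes≗does (x ≟ x′)) distinct)
   , y , y′ , sharing y≢y′ xy x′y xy′ x′y′

-- X-vertex 0 is x and X-vertices 1, 2 are its partners x₁, x₂; Y-vertices 0, 1
-- are the common neighbours of x and x₁.
disjointPairs : Pattern 3 4
disjointPairs = (# 0 , # 0) ∷ (# 0 , # 1) ∷ (# 0 , # 2) ∷ (# 0 , # 3)
              ∷ (# 1 , # 0) ∷ (# 1 , # 1) ∷ (# 2 , # 2) ∷ (# 2 , # 3) ∷ []

overlappingPairs : Pattern 3 3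
overlappingPairs = (# 0 , # 0) ∷ (# 0 , # 1) ∷ (# 0 , # 2)
                 ∷ (# 1 , # 0) ∷ (# 1 , # 1) ∷ (# 2 , # 0) ∷ (# 2 , # 2) ∷ []

samePair : Pattern 3 2
samePair = (# 0 , # 0) ∷ (# 0 , # 1) ∷ (# 1 , # 0) ∷ (# 1 , # 1) ∷ (# 2 , # 0) ∷ (# 2 , # 1) ∷ []

badCopies : ∀ m → BipGraph m → ℕ
badCopies m G = copies m disjointPairs G + (copies m overlappingPairs G + copies m samePair G)

module _ {m} (G : BipGraph m) {x x₁ x₂ : Fin m} (xs-unique : Vecᵘ.Unique (x ∷ x₁ ∷ x₂ ∷ [])) where

  private
    xs-injective : Injective _≡_ _≡_ (Vec.lookup (x ∷ x₁ ∷ x₂ ∷ []))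
    xs-injective = Vecᵘₚ.lookup-injective xs-unique _ _

  pairs-meeting : ∀ {z w w′} → SharesPair G x x₁ z w → SharesPair G x x₂ z w′ →
                  1 ≤ copies m overlappingPairs G + copies m samePair G
  pairs-meeting {z} {w} {w′} (sharing z≢w xz x₁z xw x₁w) (sharing z≢w′ _ x₂z xw′ x₂w′) with w ≟ w′
  ... | yes refl =
    ≤-trans (copy-found samePair G (from-yes (unique? samePair)) xs-injective
               (Vecᵘₚ.lookup-injective {xs = z ∷ w ∷ []} ((z≢w ∷ []) ∷ [] ∷ []) _ _)
               (xz ∷ xw ∷ x₁z ∷ x₁w ∷ x₂z ∷ x₂w′ ∷ []))
            (m≤n+m _ _)
  ... | no w≢w′  =
    ≤-trans (copy-found overlappingPairs G (from-yes (unique? overlappingPairs)) xs-injective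
               (Vecᵘₚ.lookup-injective {xs = z ∷ w ∷ w′ ∷ []} ((z≢w ∷ z≢w′ ∷ []) ∷ (w≢w′ ∷ []) ∷ [] ∷ []) _ _)
               (xz ∷ xw ∷ xw′ ∷ x₁z ∷ x₁w ∷ x₂z ∷ x₂w′ ∷ []))
            (m≤m+n _ _)

  private
    meeting : 1 ≤ copies m overlappingPairs G + copies m samePair G → 1 ≤ badCopies m G
    meeting found = ≤-trans found (m≤n+m _ (copies m disjointPairs G))

  two-shared-pairs : ∀ {y₁ y₂ y₃ y₄} → SharesPair G x x₁ y₁ y₂ → SharesPair G x x₂ y₃ y₄ →
                     1 ≤ badCopies m G
  two-shared-pairs {y₁} {y₂} {y₃} {y₄} p q with y₃ ≟ y₁ | y₃ ≟ y₂ | y₄ ≟ y₁ | y₄ ≟ y₂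
  ... | yes refl | _        | _        | _        = meeting (pairs-meeting p q)
  ... | _        | yes refl | _        | _        = meeting (pairs-meeting (SharesPair-swap p) q)
  ... | _        | _        | yes refl | _        = meeting (pairs-meeting p (SharesPair-swap q))
  ... | _        | _        | _        | yes refl = meeting (pairs-meeting (SharesPair-swap p) (SharesPair-swap q))
  ... | no y₃≢y₁ | no y₃≢y₂ | no y₄≢y₁ | no y₄≢y₂ =
    let sharing y₁≢y₂ xy₁ x₁y₁ xy₂ x₁y₂ = p
        sharing y₃≢y₄ xy₃ x₂y₃ xy₄ x₂y₄ = q
        ys-unique : Vecᵘ.Unique (y₁ ∷ y₂ ∷ y₃ ∷ y₄ ∷ [])
        ys-unique = (y₁≢y₂ ∷ ≢-sym y₃≢y₁ ∷ ≢-sym y₄≢y₁ ∷ []) ∷ (≢-sym y₃≢y₂ ∷ ≢-sym y₄≢y₂ ∷ [])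
                  ∷ (y₃≢y₄ ∷ []) ∷ [] ∷ []
    in ≤-trans (copy-found disjointPairs G (from-yes (unique? disjointPairs)) xs-injective
                  (Vecᵘₚ.lookup-injective ys-unique _ _)
                  (xy₁ ∷ xy₂ ∷ xy₃ ∷ xy₄ ∷ x₁y₁ ∷ x₁y₂ ∷ x₂y₃ ∷ x₂y₄ ∷ []))
               (m≤m+n _ _)

bad-graph-has-copy : ∀ m (G : BipGraph m) → T (isBad m G) → 1 ≤ badCopies m G
bad-graph-has-copy m G bad =
  let x , two-partners                      = anyF-elim bad
      x₁ , x₂ , x₁≢x₂ , partner₁ , partner₂ = count-witness₂ (≤ᵇ⇒≤ 2 _ two-partners)
      x≢x₁ , y₁ , y₂ , shares₁              = shares-pair G x x₁ partner₁
      x≢x₂ , y₃ , y₄ , shares₂              = shares-pair G x x₂ partner₂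
  in two-shared-pairs G ((x≢x₁ ∷ x≢x₂ ∷ []) ∷ (x₁≢x₂ ∷ []) ∷ [] ∷ []) shares₁ shares₂

-- The exponents are the numbers of edges of the three patterns.
badness-constant : ℕ → ℕ
badness-constant Δ = (2 * Δ) ^ 8 + ((2 * Δ) ^ 7 + (2 * Δ) ^ 6)

bad-count-bound : ∀ Δ m → 4 * Δ + 16 ≤ m → m * numRegularBad Δ m ≤ badness-constant Δ * numRegular Δ m
bad-count-bound Δ m m-large = begin
  m * numRegularBad Δ m
    ≡⟨ cong (m *_) (length-filter _ Gs) ⟩
  m * ∑[ G ∈ Gs ] ind (reg G ∧ isBad m G)
    ≤⟨ *-monoʳ-≤ m (∑ₗ-mono Gs bad⇒copies) ⟩
  m * ∑[ G ∈ Gs ] (ind (reg G) * badCopies m G)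
    ≡⟨ cong (m *_) split ⟩
  m * (S disjointPairs + (S overlappingPairs + S samePair))
    ≡⟨ trans (*-distribˡ-+ m _ _) (cong (m * S disjointPairs +_) (*-distribˡ-+ m _ _)) ⟩
  m * S disjointPairs + (m * S overlappingPairs + m * S samePair)
    ≤⟨ +-mono-≤ (excess-one-bound Δ m disjointPairs refl m-large)
                (+-mono-≤ (excess-one-bound Δ m overlappingPairs refl (m-large′ (m≤n+m 14 2)))
                          (excess-one-bound Δ m samePair refl (m-large′ (m≤n+m 12 4)))) ⟩
  (2 * Δ) ^ 8 * N + ((2 * Δ) ^ 7 * N + (2 * Δ) ^ 6 * N)
    ≡⟨ trans (*-distribʳ-+ N ((2 * Δ) ^ 8) _)
             (cong ((2 * Δ) ^ 8 * N +_) (*-distribʳ-+ N ((2 * Δ) ^ 7) ((2 * Δ) ^ 6))) ⟨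
  badness-constant Δ * N
    ∎
  where
  open ≤-Reasoning
  Gs : List (BipGraph m)
  Gs = allBipGraphs m
  N : ℕ
  N = numRegular Δ m
  reg : BipGraph m → Bool
  reg = isΔRegular Δ m
  S : ∀ {r s} → Pattern r s → ℕ
  S P = ∑[ G ∈ Gs ] (ind (reg G) * copies m P G)
  m-large′ : ∀ {e} → e ≤ 16 → 4 * Δ + e ≤ m
  m-large′ e≤16 = ≤-trans (+-monoʳ-≤ (4 * Δ) e≤16) m-large
  bad⇒copies : ∀ G → ind (reg G ∧ isBad m G) ≤ ind (reg G) * badCopies m G
  bad⇒copies G with reg G | isBad m G in bad
  ... | false | _     = z≤n
  ... | true  | false = z≤n
  ... | true  | true  = ≤-trans (bad-graph-has-copy m G (from T-≡ bad)) (≤-reflexive (sym (+-identityʳ _)))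
  split : ∑[ G ∈ Gs ] (ind (reg G) * badCopies m G) ≡ S disjointPairs + (S overlappingPairs + S samePair)
  split = trans (∑ₗ-cong Gs per-graph) (trans (∑ₗ-distrib-+ Gs _ _) (cong (S disjointPairs +_) (∑ₗ-distrib-+ Gs _ _)))
    where
    per-graph : ∀ G → ind (reg G) * badCopies m G
                        ≡ ind (reg G) * copies m disjointPairs G
                          + (ind (reg G) * copies m overlappingPairs G + ind (reg G) * copies m samePair G)
    per-graph G = trans (*-distribˡ-+ (ind (reg G)) _ _)
                        (cong (ind (reg G) * copies m disjointPairs G +_) (*-distribˡ-+ (ind (reg G)) _ _))

lemma3p8 : (Δ : ℕ) → (k : ℕ) → ∃[ N ] ((m : ℕ) → m ≥ N →
    suc k * numRegularBad Δ m ≤ numRegular Δ m)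
lemma3p8 Δ k = 4 * Δ + 16 + suc k * suc C , λ m m≥N → *-cancelˡ-≤ (suc C) (begin
  suc C * (suc k * numRegularBad Δ m)     ≡⟨ x*[y*z]≡y*[x*z] (suc C) (suc k) _ ⟩
  suc k * (suc C * numRegularBad Δ m)     ≡⟨ *-assoc (suc k) (suc C) _ ⟨
  suc k * suc C * numRegularBad Δ m       ≤⟨ *-monoˡ-≤ (numRegularBad Δ m) (≤-trans (m≤n+m _ (4 * Δ + 16)) m≥N) ⟩
  m * numRegularBad Δ m                   ≤⟨ bad-count-bound Δ m (≤-trans (m≤m+n (4 * Δ + 16) _) m≥N) ⟩
  C * numRegular Δ m                      ≤⟨ *-monoˡ-≤ (numRegular Δ m) (n≤1+n C) ⟩
  suc C * numRegular Δ m                  ∎)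
  where
  open ≤-Reasoning
  C : ℕ
  C = badness-constant Δ
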